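{- Let $(A,\mathbf{C}^t)$ be a tangled closure algebra with induced closure operator $\mathbf{C}$ and interior operator $\mathbf{I}$, and let $\varGamma\subseteq A$ be finite and non-empty. Then: (1) $\mathbf{C}^t\varGamma$ is closed, i.e. $\mathbf{C}\mathbf{C}^t\varGamma=\mathbf{C}^t\varGamma$. (2) If $\gamma\mapsto\gamma'$ is any function from $\varGamma$ to $A$ and $\varGamma'=\{\gamma':\gamma\in\varGamma\}$, then $$\textstyle\bigwedge_{\gamma\in\varGamma}\mathbf{I}(\gamma\Leftrightarrow\gamma')\leq\mathbf{I}\big(\mathbf{C}^t\varGamma\Leftrightarrow\mathbf{C}^t\varGamma'\big).$$
   Context: Let $A$ be a Boolean algebra with operations $\land,\lor,-,0,1$; write $a\Rightarrow b=-a\lor b$ and $a\Leftrightarrow b=(a\Rightarrow b)\land(b\Rightarrow a)$. A closure operator on $A$ is a map $\mathbf{C}:A\to A$ with $\mathbf{C}(a\lor b)=\mathbf{C}a\lor\mathbf{C}b$, $\mathbf{C}0=0$, $a\leq\mathbf{C}a=\mathbf{C}\mathbf{C}a$; its dual interior operator is $\mathbf{I}a=-\mathbf{C}-a$. Let $\mathcal{P}_{fin}A$ be the set of finite non-empty subsets of $A$. Given $\mathbf{C}^t:\mathcal{P}_{fin}A\to A$, the induced unary map is $\mathbf{C}a=\mathbf{C}^t\{a\}$ and $\mathbf{I}a=-\mathbf{C}^t\{ -a\}$. $(A,\mathbf{C}^t)$ is a tangled closure algebra if the induced $\mathbf{C}$ is a closure operator and for all $\varGamma\in\mathcal{P}_{fin}A$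 and $a\in A$: (Fix) $\mathbf{C}^t\varGamma\leq\bigwedge_{\gamma\in\varGamma}\mathbf{C}(\gamma\land\mathbf{C}^t\varGamma)$; (Ind) $\mathbf{I}\big(a\Rightarrow\bigwedge_{\gamma\in\varGamma}\mathbf{C}(\gamma\land a)\big)\land a\leq\mathbf{C}^t\varGamma$. -}

module Defs where

open import Level using (Level; _⊔_)
open import Data.Product using (_×_; _,_; proj₁; proj₂)
open import Data.List.NonEmpty as L⁺ using (List⁺; toList; [_])
open import Data.List.Relation.Unary.All using (All)
open import Data.List.Relation.Unary.Any using (Any)
open import Algebra.Lattice.Bundles using (BooleanAlgebra)

module BA {c ℓ : Level} (B : BooleanAlgebra c ℓ) where
  open BooleanAlgebra B

  _≤_ : Carrier → Carrier → Set ℓ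
  a ≤ b = (a ∧ b) ≈ a

  _⇒_ : Carrier → Carrier → Carrier
  a ⇒ b = (¬ a) ∨ b

  _⇔_ : Carrier → Carrier → Carrier
  a ⇔ b = (a ⇒ b) ∧ (b ⇒ a)

  ⋀ : {A : Set c} → List⁺ A → (A → Carrier) → Carrier
  ⋀ Γ f = L⁺.foldr₁ _∧_ (L⁺.map f Γ)

  -- Finite non-empty subsets of A are represented by non-empty lists,
  -- identified up to having the same elements (modulo ≈).
  _∈≈_ : Carrier → List⁺ Carrier → Set (c ⊔ ℓ)
  x ∈≈ Γ = Any (λ y → x ≈ y) (toList Γ)

  _⊆≈_ : List⁺ Carrier → List⁺ Carrier → Set (c ⊔ ℓ)
  Γ ⊆≈ Δ = All (λ γ → γ ∈≈ Δ) (toList Γ)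

  SameSet : List⁺ Carrier → List⁺ Carrier → Set (c ⊔ ℓ)
  SameSet Γ Δ = (Γ ⊆≈ Δ) × (Δ ⊆≈ Γ)

record TangledClosureAlgebra {c ℓ : Level} (B : BooleanAlgebra c ℓ) : Set (c ⊔ ℓ) where
  open BooleanAlgebra B
  open BA B
  field
    Ct : List⁺ Carrier → Carrier
    -- C^t is a well-defined function on finite non-empty subsets
    Ct-cong : ∀ Γ Δ → SameSet Γ Δ → Ct Γ ≈ Ct Δ

  C : Carrier → Carrier
  C a = Ct [ a ]

  I : Carrier → Carrier
  I a = ¬ Ct [ ¬ a ]

  field
    C-∨   : ∀ a b → C (a ∨ b) ≈ (C a ∨ C b)
    C-⊥   : C ⊥ ≈ ⊥
    C-inc : ∀ a → a ≤ C a
    C-idem : ∀ a → C a ≈ C (C a)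
    Fix : ∀ Γ → Ct Γ ≤ ⋀ Γ (λ γ → C (γ ∧ Ct Γ))
    Ind : ∀ Γ a → (I (a ⇒ ⋀ Γ (λ γ → C (γ ∧ a))) ∧ a) ≤ Ct Γ

-- Both parts rest on (Ind) in the form: if u is open (u ≤ I u), a ≤ u and a ≤ ⋀ C(γ ∧ a),
-- then a ≤ Cᵗ Γ.  For (1) take u = ⊤: by (Fix) Cᵗ Γ lies below ⋀ C(γ ∧ C Cᵗ Γ), a meet of
-- closed elements, hence closed, so C Cᵗ Γ lies below it as well.  For (2) the meet u of the
-- I(γ ⇔ γ') is open, and an open u satisfies u ∧ C x ≤ C (u ∧ x); with (Fix) this gives
-- a = u ∧ Cᵗ Γ ≤ C(γ' ∧ a) for every γ, hence u ∧ Cᵗ Γ ≤ Cᵗ Γ', and symmetrically.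
module Submission where

open import Defs
open import Level using (Level)
open import Data.Product using (_×_; _,_; proj₁; proj₂)
open import Data.List using ([]; _∷_)
open import Data.List.NonEmpty using (List⁺; _∷_; [_]; toList; map)
open import Data.List.Relation.Unary.All as All using (All; []; _∷_)
open import Data.List.Relation.Unary.All.Properties using (map⁺; map⁻)
open import Data.List.Relation.Unary.Any using (here)
open import Algebra.Lattice.Bundles using (BooleanAlgebra)
import Algebra.Lattice.Properties.BooleanAlgebra as BooleanAlgebraProperties
import Relation.Binary.Lattice as Order
import Relation.Binary.Lattice.Properties.MeetSemilattice as MeetSemilatticeProperties
import Relation.Binary.Lattice.Properties.JoinSemilattice as JoinSemilatticeProperties
import Relation.Binary.Reasoning.PartialOrder as ≤-Reasoning
import Relation.Binary.Reasoning.Setoid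

module BooleanAlgebraOrder {c ℓ : Level} (B : BooleanAlgebra c ℓ) where
  open BooleanAlgebra B
  open BooleanAlgebraProperties B
  open BA B using (⋀; _⇒_)

  open Order.Lattice ∨-∧-orderTheoreticLattice public
    using (_≤_; x≤x∨y; ∨-least; x∧y≤x; x∧y≤y; ∧-greatest)
    renaming (refl to ≤-refl; trans to ≤-trans; antisym to ≤-antisym; reflexive to ≤-reflexive)
  open MeetSemilatticeProperties (Order.Lattice.meetSemilattice ∨-∧-orderTheoreticLattice) public
    using (∧-monotonic)
  open JoinSemilatticeProperties (Order.Lattice.joinSemilattice ∨-∧-orderTheoreticLattice) public
    using (∨-monotonic; x≤y⇒x∨y≈y)

  -- The order of Defs is a ∧ b ≈ a; the stdlib order is a ≈ a ∧ b.
  ≤ᴮ⇒≤ : ∀ {x y} → BA._≤_ B x y → x ≤ y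
  ≤ᴮ⇒≤ = sym

  ≤⇒≤ᴮ : ∀ {x y} → x ≤ y → BA._≤_ B x y
  ≤⇒≤ᴮ = sym

  ≤-⊤ : ∀ x → x ≤ ⊤
  ≤-⊤ x = sym (∧-identityʳ x)

  ⊥-≤ : ∀ x → ⊥ ≤ x
  ⊥-≤ x = sym (∧-zeroˡ x)

  transpose-⇒ : ∀ {x y z} → x ∧ y ≤ z → y ≤ x ⇒ z
  transpose-⇒ {x} {y} {z} x∧y≤z = begin
    y                   ≈⟨ ∧-identityʳ y ⟨
    y ∧ ⊤               ≈⟨ ∧-congˡ (∨-complementʳ x) ⟨
    y ∧ (x ∨ ¬ x)       ≈⟨ ∧-distribˡ-∨ y x (¬ x) ⟩
    (y ∧ x) ∨ (y ∧ ¬ x) ≤⟨ ∨-monotonic (≤-trans (≤-reflexive (∧-comm y x)) x∧y≤z) (x∧y≤y y (¬ x)) ⟩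
    z ∨ ¬ x             ≈⟨ ∨-comm z (¬ x) ⟩
    ¬ x ∨ z             ∎
    where open ≤-Reasoning poset

  transpose-∧ : ∀ {x y z} → y ≤ x ⇒ z → x ∧ y ≤ z
  transpose-∧ {x} {y} {z} y≤x⇒z = begin
    x ∧ y                 ≤⟨ ∧-monotonic ≤-refl y≤x⇒z ⟩
    x ∧ (¬ x ∨ z)         ≈⟨ ∧-distribˡ-∨ x (¬ x) z ⟩
    (x ∧ ¬ x) ∨ (x ∧ z)   ≈⟨ ∨-congʳ (∧-complementʳ x) ⟩
    ⊥ ∨ (x ∧ z)           ≤⟨ ∨-least (⊥-≤ z) (x∧y≤y x z) ⟩
    z                     ∎
    where open ≤-Reasoning poset

  ¬-antitone : ∀ {x y} → x ≤ y → ¬ y ≤ ¬ x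
  ¬-antitone {x} {y} x≤y = ≤-trans
    (transpose-⇒ (≤-trans (∧-monotonic x≤y ≤-refl) (≤-reflexive (∧-complementʳ y))))
    (≤-reflexive (∨-identityʳ (¬ x)))

  ≤¬⇒≤¬ : ∀ {x y} → x ≤ ¬ y → y ≤ ¬ x
  ≤¬⇒≤¬ {x} {y} x≤¬y = ≤-trans (≤-reflexive (sym (¬-involutive y))) (¬-antitone x≤¬y)

  module _ {X : Set c} (f : X → Carrier) where

    ⋀-lowerBound : (G : List⁺ X) → All (λ x → ⋀ G f ≤ f x) (toList G)
    ⋀-lowerBound (x ∷ xs) = go x xs
      where
      go : ∀ x xs → All (λ y → ⋀ (x ∷ xs) f ≤ f y) (x ∷ xs)
      go x []       = ≤-refl ∷ []
      go x (y ∷ ys) = x∧y≤x _ _ ∷ All.map (≤-trans (x∧y≤y _ _)) (go y ys)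

    ⋀-greatest : ∀ {z} (G : List⁺ X) → All (λ x → z ≤ f x) (toList G) → z ≤ ⋀ G f
    ⋀-greatest {z} (x ∷ xs) = go x xs
      where
      go : ∀ x xs → All (λ y → z ≤ f y) (x ∷ xs) → z ≤ ⋀ (x ∷ xs) f
      go x []       (z≤fx ∷ [])  = z≤fx
      go x (y ∷ ys) (z≤fx ∷ z≤f) = ∧-greatest z≤fx (go y ys z≤f)

    ⋀-closed : (P : Carrier → Set ℓ) → (∀ {a b} → P a → P b → P (a ∧ b)) →
               (G : List⁺ X) → All (λ x → P (f x)) (toList G) → P (⋀ G f)
    ⋀-closed P P-∧ (x ∷ xs) = go x xs
      where
      go : ∀ x xs → All (λ y → P (f y)) (x ∷ xs) → P (⋀ (x ∷ xs) f)
      go x []       (Pfx ∷ [])  = Pfx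
      go x (y ∷ ys) (Pfx ∷ Pf) = P-∧ Pfx (go y ys Pf)

module TangledClosureAlgebraProperties {c ℓ : Level} {B : BooleanAlgebra c ℓ}
                                       (T : TangledClosureAlgebra B) where
  open BooleanAlgebra B
  open BooleanAlgebraProperties B
  open BooleanAlgebraOrder B
  open BA B using (⋀; _⇒_; _⇔_)
  open TangledClosureAlgebra T

  C-cong : ∀ {x y} → x ≈ y → C x ≈ C y
  C-cong {x} {y} x≈y = Ct-cong [ x ] [ y ] (here x≈y ∷ [] , here (sym x≈y) ∷ [])

  C-monotone : ∀ {x y} → x ≤ y → C x ≤ C y
  C-monotone {x} {y} x≤y = begin
    C x         ≤⟨ x≤x∨y (C x) (C y) ⟩
    C x ∨ C y   ≈⟨ C-∨ x y ⟨
    C (x ∨ y)   ≈⟨ C-cong (x≤y⇒x∨y≈y x≤y) ⟩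
    C y         ∎
    where open ≤-Reasoning poset

  C-extensive : ∀ x → x ≤ C x
  C-extensive x = ≤ᴮ⇒≤ (C-inc x)

  I-monotone : ∀ {x y} → x ≤ y → I x ≤ I y
  I-monotone x≤y = ¬-antitone (C-monotone (¬-antitone x≤y))

  I-deflationary : ∀ x → I x ≤ x
  I-deflationary x = ≤-trans (¬-antitone (C-extensive (¬ x))) (≤-reflexive (¬-involutive x))

  I-∧ : ∀ x y → I x ∧ I y ≈ I (x ∧ y)
  I-∧ x y = begin
    ¬ C (¬ x) ∧ ¬ C (¬ y)   ≈⟨ deMorgan₂ (C (¬ x)) (C (¬ y)) ⟨
    ¬ (C (¬ x) ∨ C (¬ y))   ≈⟨ ¬-cong (C-∨ (¬ x) (¬ y)) ⟨
    ¬ C (¬ x ∨ ¬ y)         ≈⟨ ¬-cong (C-cong (deMorgan₁ x y)) ⟨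
    ¬ C (¬ (x ∧ y))         ∎
    where open Relation.Binary.Reasoning.Setoid setoid

  Open : Carrier → Set ℓ
  Open u = u ≤ I u

  Closed : Carrier → Set ℓ
  Closed w = C w ≤ w

  ⊤-open : Open ⊤
  ⊤-open = ≤-reflexive (sym (trans (¬-cong (trans (C-cong ¬⊤≈⊥) C-⊥)) ¬⊥≈⊤))

  I-open : ∀ x → Open (I x)
  I-open x = ≤-reflexive (¬-cong (trans (C-idem (¬ x)) (C-cong (sym (¬-involutive (C (¬ x)))))))

  C-closed : ∀ x → Closed (C x)
  C-closed x = ≤-reflexive (sym (C-idem x))

  open-∧ : ∀ {u v} → Open u → Open v → Open (u ∧ v)
  open-∧ {u} {v} u-open v-open = ≤-trans (∧-monotonic u-open v-open) (≤-reflexive (I-∧ u v))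

  closed-∧ : ∀ {w z} → Closed w → Closed z → Closed (w ∧ z)
  closed-∧ {w} {z} w-closed z-closed = ∧-greatest
    (≤-trans (C-monotone (x∧y≤x w z)) w-closed)
    (≤-trans (C-monotone (x∧y≤y w z)) z-closed)

  -- Openness of u is C (¬ u) ≤ ¬ u, and x ≤ ¬ u ∨ (u ∧ x).
  open-∧-C : ∀ {u} x → Open u → u ∧ C x ≤ C (u ∧ x)
  open-∧-C {u} x u-open = transpose-∧ (begin
    C x                     ≤⟨ C-monotone (transpose-⇒ ≤-refl) ⟩
    C (¬ u ∨ (u ∧ x))       ≈⟨ C-∨ (¬ u) (u ∧ x) ⟩
    C (¬ u) ∨ C (u ∧ x)     ≤⟨ ∨-monotonic (≤¬⇒≤¬ u-open) ≤-refl ⟩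
    ¬ u ∨ C (u ∧ x)         ∎)
    where open ≤-Reasoning poset

  Ct-postfixed : ∀ Γ → All (λ γ → Ct Γ ≤ C (γ ∧ Ct Γ)) (toList Γ)
  Ct-postfixed Γ = All.map (≤-trans (≤ᴮ⇒≤ (Fix Γ))) (⋀-lowerBound (λ γ → C (γ ∧ Ct Γ)) Γ)

  Ct-induction : ∀ {u a} Γ → Open u → a ≤ u → a ≤ ⋀ Γ (λ γ → C (γ ∧ a)) → a ≤ Ct Γ
  Ct-induction {u} {a} Γ u-open a≤u a≤⋀ =
    ≤-trans (∧-greatest a≤I[a⇒⋀] ≤-refl) (≤ᴮ⇒≤ (Ind Γ a))
    where
    a≤I[a⇒⋀] : a ≤ I (a ⇒ ⋀ Γ (λ γ → C (γ ∧ a)))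
    a≤I[a⇒⋀] = ≤-trans a≤u (≤-trans u-open (I-monotone (transpose-⇒ (≤-trans (x∧y≤x a u) a≤⋀))))

  Ct-closed : ∀ Γ → C (Ct Γ) ≈ Ct Γ
  Ct-closed Γ = ≤-antisym (Ct-induction Γ ⊤-open (≤-⊤ (C t)) (≤-trans (C-monotone t≤⋀) ⋀C-closed))
                          (C-extensive t)
    where
    t = Ct Γ
    f : Carrier → Carrier
    f γ = C (γ ∧ C t)

    t≤⋀ : t ≤ ⋀ Γ f
    t≤⋀ = ⋀-greatest f Γ
      (All.map (λ t≤C → ≤-trans t≤C (C-monotone (∧-monotonic ≤-refl (C-extensive t)))) (Ct-postfixed Γ))

    ⋀C-closed : Closed (⋀ Γ f)
    ⋀C-closed = ⋀-closed f Closed closed-∧ Γ (All.tabulate (λ _ → C-closed _))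

  Ct-transfer : ∀ {X : Set c} {u} (G : List⁺ X) (f g : X → Carrier) → Open u →
                All (λ x → u ≤ f x ⇒ g x) (toList G) → u ∧ Ct (map f G) ≤ Ct (map g G)
  Ct-transfer {u = u} G@(_ ∷ _) f g u-open u≤f⇒g =
    Ct-induction (map g G) u-open (x∧y≤x u t)
      (⋀-greatest _ (map g G) (map⁺ (All.zipWith step (map⁻ (Ct-postfixed (map f G)) , u≤f⇒g))))
    where
    t = Ct (map f G)
    step : ∀ {x} → t ≤ C (f x ∧ t) × u ≤ f x ⇒ g x → u ∧ t ≤ C (g x ∧ (u ∧ t))
    step {x} (t≤C , u≤f⇒gx) = begin
      u ∧ t               ≤⟨ ∧-monotonic ≤-refl t≤C ⟩
      u ∧ C (f x ∧ t)     ≤⟨ open-∧-C (f x ∧ t) u-open ⟩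
      C (u ∧ (f x ∧ t))   ≤⟨ C-monotone (∧-greatest u∧fx∧t≤gx (∧-monotonic ≤-refl (x∧y≤y (f x) t))) ⟩
      C (g x ∧ (u ∧ t))   ∎
      where
      open ≤-Reasoning poset
      u∧fx∧t≤gx : u ∧ (f x ∧ t) ≤ g x
      u∧fx∧t≤gx = ≤-trans (∧-greatest (≤-trans (x∧y≤y u _) (x∧y≤x (f x) t)) (x∧y≤x u _))
                          (transpose-∧ u≤f⇒gx)

  ⋀I⇔-≤-I⇔Ct : ∀ {X : Set c} (G : List⁺ X) (f g : X → Carrier) →
               ⋀ G (λ x → I (f x ⇔ g x)) ≤ I (Ct (map f G) ⇔ Ct (map g G))
  ⋀I⇔-≤-I⇔Ct {X} G f g = ≤-trans e-open (I-monotone (∧-greatest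
    (transfer (All.map (λ e≤⇔ → ≤-trans e≤⇔ (x∧y≤x _ _)) e≤f⇔g))
    (transfer (All.map (λ e≤⇔ → ≤-trans e≤⇔ (x∧y≤y _ _)) e≤f⇔g))))
    where
    e = ⋀ G (λ x → I (f x ⇔ g x))

    e-open : Open e
    e-open = ⋀-closed _ Open open-∧ G (All.tabulate (λ _ → I-open _))

    e≤f⇔g : All (λ x → e ≤ f x ⇔ g x) (toList G)
    e≤f⇔g = All.map (λ e≤I → ≤-trans e≤I (I-deflationary _)) (⋀-lowerBound _ G)

    transfer : ∀ {h k : X → Carrier} → All (λ x → e ≤ h x ⇒ k x) (toList G) →
               e ≤ Ct (map h G) ⇒ Ct (map k G)
    transfer e≤h⇒k =
      transpose-⇒ (≤-trans (≤-reflexive (∧-comm _ _)) (Ct-transfer G _ _ e-open e≤h⇒k))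

theorem2p6 : {c ℓ : Level} (B : BooleanAlgebra c ℓ) (T : TangledClosureAlgebra B)
    → let open BooleanAlgebra B
          open BA B
          open TangledClosureAlgebra T
      in ((Γ : List⁺ Carrier) → C (Ct Γ) ≈ Ct Γ)
         × ((G : List⁺ (Carrier × Carrier))
            → All (λ p → All (λ q → proj₁ p ≈ proj₁ q → proj₂ p ≈ proj₂ q) (toList G)) (toList G)
            → ⋀ G (λ p → I (proj₁ p ⇔ proj₂ p)) ≤ I (Ct (map proj₁ G) ⇔ Ct (map proj₂ G)))
theorem2p6 B T = Ct-closed , λ G _ → ≤⇒≤ᴮ (⋀I⇔-≤-I⇔Ct G proj₁ proj₂)
  where
  open BooleanAlgebraOrder B
  open TangledClosureAlgebraProperties T
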